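{- For all integers $r,t\ge 3$, the global offensive alliance number of the torus graph $C_r\Box C_t$ is $$\gamma_o(C_{r}\Box C_{t})=\left\lceil\frac{rt}{2}\right\rceil.$$
   Context: All graphs are finite and simple; $C_n$ is the cycle on $n$ vertices. For a graph with vertex set $V$, a vertex $v$ and $S\subseteq V$, let $\delta_S(v)=|N(v)\cap S|$ and $\overline{S}=V\setminus S$. A nonempty set $S\subseteq V$ is a global offensive alliance if $\delta_S(v)\ge \delta_{\overline{S}}(v)+1$ for every $v\in\overline{S}$; $\gamma_o(G)$ is the minimum cardinality of a global offensive alliance of $G$. $G\Box H$ is the Cartesian product: vertex set $V(G)\times V(H)$, with $(a,b)\sim(c,d)$ iff ($a=c$ and $b\sim d$ in $H$) or ($a\sim c$ in $G$ and $b=d$). -}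

module Defs where

open import Data.Nat using (ℕ; zero; suc; _+_; _*_; _≤_; _<_; _/_)
open import Data.Bool using (Bool; true; false; _∧_; _∨_; not; if_then_else_)
open import Data.Fin using (Fin; toℕ; combine; remQuot)
open import Data.Fin.Subset using (Subset; ∣_∣; Nonempty; _∈_; _∉_; ∁)
open import Data.Fin.Subset.Properties using (_∈?_)
open import Data.Vec using (tabulate)
open import Data.Product using (_×_; _,_; proj₁; proj₂; ∃)
open import Relation.Nullary.Decidable using (⌊_⌋)
import Data.Fin.Properties as FinP
import Data.Nat.Properties as NatP
open import Relation.Binary.PropositionalEquality using (_≡_; refl)
open import Relation.Nullary using (yes; no)
open import Data.Empty using (⊥-elim)
import Data.Empty
import Data.Nat
import Relation.Binary.PropositionalEquality

record Graph : Set where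
  field
    n    : ℕ
    adj  : Fin n → Fin n → Bool
    sym  : ∀ u v → adj u v ≡ adj v u
    irr  : ∀ v → adj v v ≡ false
open Graph public

N : (G : Graph) → Fin (n G) → Subset (n G)
N G v = tabulate (adj G v)

_∩'_ : ∀ {m} → Subset m → Subset m → Subset m
_∩'_ {m} A B = tabulate (λ i → ⌊ i ∈? A ⌋ ∧ ⌊ i ∈? B ⌋)

δ : (G : Graph) → Subset (n G) → Fin (n G) → ℕ
δ G S v = ∣ N G v ∩' S ∣

IsGOA : (G : Graph) → Subset (n G) → Set
IsGOA G S = Nonempty S × (∀ v → v ∉ S → δ G (∁ S) v + 1 ≤ δ G S v)

GOANumberIs : Graph → ℕ → Set
GOANumberIs G k =
  (∃ λ (S : Subset (n G)) → IsGOA G S × ∣ S ∣ ≡ k)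
  × (∀ (S : Subset (n G)) → IsGOA G S → k ≤ ∣ S ∣)

-- Cycle C_m (m ≥ 3): i ~ j iff j ≡ i ± 1 (mod m).
cycAdj : (m : ℕ) → Fin m → Fin m → Bool
cycAdj m i j =
  ⌊ NatP._≟_ (suc (toℕ i)) (toℕ j) ⌋ ∨ ⌊ NatP._≟_ (suc (toℕ j)) (toℕ i) ⌋
  ∨ (⌊ NatP._≟_ (suc (toℕ i)) m ⌋ ∧ ⌊ NatP._≟_ (toℕ j) 0 ⌋)
  ∨ (⌊ NatP._≟_ (suc (toℕ j)) m ⌋ ∧ ⌊ NatP._≟_ (toℕ i) 0 ⌋)

private
  ∨-comm : ∀ a b → a ∨ b ≡ b ∨ a
  ∨-comm false false = _≡_.refl
  ∨-comm false true = _≡_.refl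
  ∨-comm true false = _≡_.refl
  ∨-comm true true = _≡_.refl

  cycSym : ∀ m (i j : Fin m) → cycAdj m i j ≡ cycAdj m j i
  cycSym m i j with ⌊ NatP._≟_ (suc (toℕ i)) (toℕ j) ⌋ | ⌊ NatP._≟_ (suc (toℕ j)) (toℕ i) ⌋
              | ⌊ NatP._≟_ (suc (toℕ i)) m ⌋ ∧ ⌊ NatP._≟_ (toℕ j) 0 ⌋
              | ⌊ NatP._≟_ (suc (toℕ j)) m ⌋ ∧ ⌊ NatP._≟_ (toℕ i) 0 ⌋
  ... | false | false | false | false = _≡_.refl
  ... | false | false | false | true = _≡_.refl
  ... | false | false | true | false = _≡_.refl
  ... | false | false | true | true = _≡_.refl
  ... | false | true | c | d = _≡_.refl
  ... | true | false | c | d = _≡_.refl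
  ... | true | true | c | d = _≡_.refl

  n≢1+n : ∀ k → ⌊ NatP._≟_ (suc k) k ⌋ ≡ false
  n≢1+n k with NatP._≟_ (suc k) k
  ... | yes p = ⊥-elim (NatP.1+n≢n p)
  ... | no _ = _≡_.refl

  cycIrr : ∀ m → 3 ≤ m → (i : Fin m) → cycAdj m i i ≡ false
  cycIrr m h i rewrite n≢1+n (toℕ i) with NatP._≟_ (suc (toℕ i)) m | toℕ i NatP.≟ 0
  ... | no _ | _ = refl
  ... | yes _ | no _ = refl
  ... | yes p | yes q = ⊥-elim (bad h p q)
    where
      bad : ∀ {m k} → 3 ≤ m → suc k ≡ m → k ≡ 0 → Data.Empty.⊥
      bad {k = zero} h refl _ with h
      ... | Data.Nat.s≤s ()

C : (m : ℕ) → 3 ≤ m → Graph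
C m h = record { n = m ; adj = cycAdj m ; sym = cycSym m ; irr = cycIrr m h }

-- Cartesian product G □ H, vertex (a , b) encoded as combine a b : Fin (n G * n H).
pairAdj : (G H : Graph) → Fin (n G) × Fin (n H) → Fin (n G) × Fin (n H) → Bool
pairAdj G H (a , b) (c , d) =
  (⌊ a FinP.≟ c ⌋ ∧ adj H b d) ∨ (adj G a c ∧ ⌊ b FinP.≟ d ⌋)

□adj : (G H : Graph) → Fin (n G * n H) → Fin (n G * n H) → Bool
□adj G H x y = pairAdj G H (remQuot {n G} (n H) x) (remQuot {n G} (n H) y)

private
  ≟-sym : ∀ {k} (a c : Fin k) → ⌊ a FinP.≟ c ⌋ ≡ ⌊ c FinP.≟ a ⌋
  ≟-sym a c with a FinP.≟ c | c FinP.≟ a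
  ... | yes _ | yes _ = refl
  ... | no _ | no _ = refl
  ... | yes p | no q = ⊥-elim (q (Relation.Binary.PropositionalEquality.sym p))
  ... | no p | yes q = ⊥-elim (p (Relation.Binary.PropositionalEquality.sym q))

  ≟-refl : ∀ {k} (a : Fin k) → ⌊ a FinP.≟ a ⌋ ≡ true
  ≟-refl a with a FinP.≟ a
  ... | yes _ = refl
  ... | no q = ⊥-elim (q refl)

  pSym : (G H : Graph) → ∀ p q → pairAdj G H p q ≡ pairAdj G H q p
  pSym G H (a , b) (c , d) rewrite ≟-sym a c | sym H b d | sym G a c | ≟-sym b d = refl

  pIrr : (G H : Graph) → ∀ p → pairAdj G H p p ≡ false
  pIrr G H (a , b) rewrite ≟-refl a | ≟-refl b | irr H b | irr G a = refl

  □sym : (G H : Graph) → ∀ x y → □adj G H x y ≡ □adj G H y x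
  □sym G H x y = pSym G H (remQuot {n G} (n H) x) (remQuot {n G} (n H) y)

  □irr : (G H : Graph) → ∀ x → □adj G H x x ≡ false
  □irr G H x = pIrr G H (remQuot {n G} (n H) x)

_□_ : Graph → Graph → Graph
G □ H = record { n = n G * n H ; adj = □adj G H ; sym = □sym G H ; irr = □irr G H }

-- A vertex outside a global offensive alliance S of the 4-regular torus has at least three of
-- its four neighbours in S, hence at most one outside S; so no three vertices of a 4-cycle lie
-- outside S. Each vertex lies on exactly four of the squares {(a,b), (a+1,b), (a,b+1), (a+1,b+1)},
-- so counting the vertices outside S over all squares gives 4 |V ∖ S| ≤ 2 r t, i.e.
-- |S| ≥ ⌈r t / 2⌉. Conversely the vertices (a,b) with a + b even form an alliance: if a is odd,
-- then a - 1 and a + 1 (mod r) are even, and one of b ± 1 (mod t) has parity opposite to b, which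
-- gives three neighbours in the set (symmetrically if b is odd). For even t, shifting b by one
-- exchanges this set with its complement; for odd t, the parity of a + b is that of the index
-- t a + b; in both cases the set has at most ⌈r t / 2⌉ elements.

module Submission where

open import Data.Bool using (Bool; true; false; _∧_; if_then_else_; T)
open import Data.Bool.Properties using (T-∨; T-∧; T-≡)
open import Data.Empty using (⊥; ⊥-elim)
open import Data.Fin as Fin using (Fin; zero; suc; toℕ; combine; remQuot)
import Data.Fin.Properties as FP
open import Data.Fin.Permutation as Perm using (Permutation; permutation; _⟨$⟩ʳ_; _⟨$⟩ˡ_)
open import Data.Fin.Subset using (Subset; ∣_∣; _∈_; _∉_; ∁; _∩_; _∪_; ⋃; ⁅_⁆)
open import Data.Fin.Subset.Properties
  using ( _∈?_; drop-there; x∈⁅x⁆; x∈p∪q⁺; x∈p∩q⁺; x∈∁p⇒x∉p; x∈p∧x≢y⇒x∈p-y; x∈p⇒∣p-x∣<∣p∣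
        ; p⊆q⇒∣p∣≤∣q∣; ∣⊥∣≡0; ∣⁅x⁆∣≡1; ∣∁p∣≡n∸∣p∣; ∣p∣≤n)
open import Data.List as List using (List; []; _∷_; length)
open import Data.List.Membership.Propositional using () renaming (_∈_ to _∈ₗ_)
open import Data.List.Relation.Unary.All as All using (All; []; _∷_)
open import Data.List.Relation.Unary.Any using (here; there)
open import Data.List.Relation.Unary.Unique.Propositional using (Unique; []; _∷_)
open import Data.Nat as ℕ using (ℕ; zero; suc; parity; _+_; _*_; _≤_; _<_; _/_; z≤n; s≤s)
open import Data.Nat.DivMod using (m<n*o⇒m/o<n; m*n/n≡m; /-monoˡ-≤)
import Data.Nat.Properties as ℕ
open import Algebra.Properties.CommutativeMonoid.Sum ℕ.+-0-commutativeMonoid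
  using (sum-syntax; sum; ∑-distrib-+; sum-cong-≗; sum-permute)
open import Data.Parity.Base using (Parity; 0ℙ; 1ℙ; _⁻¹) renaming (_+_ to _ℙ+_; _*_ to _ℙ*_)
import Data.Parity.Properties as ℙ
open import Data.Product as Product using (_×_; _,_; proj₂; ∃; uncurry)
open import Data.Sum as Sum using (_⊎_; inj₁; inj₂)
open import Data.Vec using ([]; _∷_; lookup; tabulate; here; there)
import Data.Vec.Properties as Vec
open import Function using (id; _∘_; case_of_)
open import Function.Bundles using (_⇔_; mk⇔; Equivalence)
open import Relation.Binary.PropositionalEquality
open import Relation.Nullary using (yes; no; contradiction)
open import Relation.Nullary.Decidable using (⌊_⌋; ⌊⌋-map′; toWitness; fromWitness)

open import Defs hiding (sym)

open ≡-Reasoning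

private variable
  m : ℕ

-- Sums over Fin m and sizes of subsets

𝟙 : Bool → ℕ
𝟙 b = if b then 1 else 0

χ : Subset m → Fin m → ℕ
χ p i = 𝟙 ⌊ i ∈? p ⌋

⌊∈?⌋≡lookup : (i : Fin m) (p : Subset m) → ⌊ i ∈? p ⌋ ≡ lookup p i
⌊∈?⌋≡lookup zero    (true  ∷ p) = refl
⌊∈?⌋≡lookup zero    (false ∷ p) = refl
⌊∈?⌋≡lookup (suc i) (_     ∷ p) = trans (⌊⌋-map′ there drop-there (i ∈? p)) (⌊∈?⌋≡lookup i p)

χ-lookup : (p : Subset m) (i : Fin m) → χ p i ≡ 𝟙 (lookup p i)
χ-lookup p i = cong 𝟙 (⌊∈?⌋≡lookup i p)

χ-tabulate : (f : Fin m → Bool) (i : Fin m) → χ (tabulate f) i ≡ 𝟙 (f i)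
χ-tabulate f i = trans (χ-lookup (tabulate f) i) (cong 𝟙 (Vec.lookup∘tabulate f i))

∣p∣≡∑χ : (p : Subset m) → ∣ p ∣ ≡ ∑[ i < m ] χ p i
∣p∣≡∑χ p = trans (∣p∣≡∑lookup p) (sum-cong-≗ (λ i → sym (χ-lookup p i)))
  where
  ∣p∣≡∑lookup : ∀ {m} (p : Subset m) → ∣ p ∣ ≡ ∑[ i < m ] 𝟙 (lookup p i)
  ∣p∣≡∑lookup []          = refl
  ∣p∣≡∑lookup (true ∷ p)  = cong suc (∣p∣≡∑lookup p)
  ∣p∣≡∑lookup (false ∷ p) = ∣p∣≡∑lookup p

∑-const : ∀ m c → ∑[ i < m ] c ≡ m * c
∑-const zero    c = refl
∑-const (suc m) c = cong (c +_) (∑-const m c)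

∑-mono-≤ : ∀ m {f g : Fin m → ℕ} → (∀ i → f i ≤ g i) → ∑[ i < m ] f i ≤ ∑[ i < m ] g i
∑-mono-≤ zero    f≤g = z≤n
∑-mono-≤ (suc m) f≤g = ℕ.+-mono-≤ (f≤g zero) (∑-mono-≤ m (λ i → f≤g (suc i)))

∑-invariant : (π : Permutation m m) (f : Fin m → ℕ) → ∑[ i < m ] f (π ⟨$⟩ʳ i) ≡ ∑[ i < m ] f i
∑-invariant π f = sym (sum-permute f π)

∑-square : (π ρ : Permutation m m) (f : Fin m → ℕ) → let s = ∑[ i < m ] f i in
           ∑[ i < m ] (f i + f (π ⟨$⟩ʳ i) + f (ρ ⟨$⟩ʳ i) + f (π ⟨$⟩ʳ (ρ ⟨$⟩ʳ i))) ≡ s + s + s + s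
∑-square {m} π ρ f = begin
  ∑[ i < m ] (f i + f (π ⟨$⟩ʳ i) + f (ρ ⟨$⟩ʳ i) + f (π ⟨$⟩ʳ (ρ ⟨$⟩ʳ i)))
    ≡⟨ trans (∑-distrib-+ (λ i → f i + fπ i + fρ i) fπρ)
             (cong (_+ ∑ fπρ) (trans (∑-distrib-+ (λ i → f i + fπ i) fρ) (cong (_+ ∑ fρ) (∑-distrib-+ f fπ)))) ⟩
  ∑ f + ∑ fπ + ∑ fρ + ∑ fπρ
    ≡⟨ cong₂ _+_ (cong₂ _+_ (cong (∑ f +_) (∑-invariant π f)) (∑-invariant ρ f))
                 (trans (∑-invariant ρ fπ) (∑-invariant π f)) ⟩
  ∑ f + ∑ f + ∑ f + ∑ f ∎
  where
  ∑ : (Fin m → ℕ) → ℕ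
  ∑ = sum
  fπ fρ fπρ : Fin m → ℕ
  fπ i  = f (π ⟨$⟩ʳ i)
  fρ i  = f (ρ ⟨$⟩ʳ i)
  fπρ i = f (π ⟨$⟩ʳ (ρ ⟨$⟩ʳ i))

∣p∣+∣∁p∣≡n : (p : Subset m) → ∣ p ∣ + ∣ ∁ p ∣ ≡ m
∣p∣+∣∁p∣≡n p rewrite ∣∁p∣≡n∸∣p∣ p = ℕ.m+[n∸m]≡n (∣p∣≤n p)

∣p∩q∣+∣p∩∁q∣≡∣p∣ : (p q : Subset m) → ∣ p ∩ q ∣ + ∣ p ∩ ∁ q ∣ ≡ ∣ p ∣
∣p∩q∣+∣p∩∁q∣≡∣p∣ []          []          = refl
∣p∩q∣+∣p∩∁q∣≡∣p∣ (false ∷ p) (_     ∷ q) = ∣p∩q∣+∣p∩∁q∣≡∣p∣ p q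
∣p∩q∣+∣p∩∁q∣≡∣p∣ (true  ∷ p) (true  ∷ q) = cong suc (∣p∩q∣+∣p∩∁q∣≡∣p∣ p q)
∣p∩q∣+∣p∩∁q∣≡∣p∣ (true  ∷ p) (false ∷ q) =
  trans (ℕ.+-suc _ _) (cong suc (∣p∩q∣+∣p∩∁q∣≡∣p∣ p q))

∣p∪q∣≤∣p∣+∣q∣ : (p q : Subset m) → ∣ p ∪ q ∣ ≤ ∣ p ∣ + ∣ q ∣
∣p∪q∣≤∣p∣+∣q∣ []          []          = z≤n
∣p∪q∣≤∣p∣+∣q∣ (true  ∷ p) (true  ∷ q) = s≤s (ℕ.≤-trans (∣p∪q∣≤∣p∣+∣q∣ p q) (ℕ.+-monoʳ-≤ ∣ p ∣ (ℕ.n≤1+n _)))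
∣p∪q∣≤∣p∣+∣q∣ (true  ∷ p) (false ∷ q) = s≤s (∣p∪q∣≤∣p∣+∣q∣ p q)
∣p∪q∣≤∣p∣+∣q∣ (false ∷ p) (true  ∷ q) = ℕ.≤-trans (s≤s (∣p∪q∣≤∣p∣+∣q∣ p q)) (ℕ.≤-reflexive (sym (ℕ.+-suc _ _)))
∣p∪q∣≤∣p∣+∣q∣ (false ∷ p) (false ∷ q) = ∣p∪q∣≤∣p∣+∣q∣ p q

length≤∣p∣ : {p : Subset m} {xs : List (Fin m)} → Unique xs → All (_∈ p) xs → length xs ≤ ∣ p ∣
length≤∣p∣ []            []            = z≤n
length≤∣p∣ (x≢xs ∷ uniq) (x∈p ∷ xs∈p) =
  ℕ.≤-trans (s≤s (length≤∣p∣ uniq (All.zipWith (λ (y∈p , x≢y) → x∈p∧x≢y⇒x∈p-y y∈p (x≢y ∘ sym)) (xs∈p , x≢xs))))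
            (x∈p⇒∣p-x∣<∣p∣ x∈p)

∣p∣≤length : {p : Subset m} (xs : List (Fin m)) → (∀ {x} → x ∈ p → x ∈ₗ xs) → ∣ p ∣ ≤ length xs
∣p∣≤length {m = m} xs p⊆xs = ℕ.≤-trans (p⊆q⇒∣p∣≤∣q∣ (∈⋃⁅⁆ xs ∘ p⊆xs)) (∣⋃⁅⁆∣≤length xs)
  where
  ⋃⁅⁆ : List (Fin m) → Subset m
  ⋃⁅⁆ xs = ⋃ (List.map ⁅_⁆ xs)
  ∈⋃⁅⁆ : ∀ xs {x} → x ∈ₗ xs → x ∈ ⋃⁅⁆ xs
  ∈⋃⁅⁆ (x ∷ _)  (here refl)  = x∈p∪q⁺ (inj₁ (x∈⁅x⁆ x))
  ∈⋃⁅⁆ (_ ∷ xs) (there x∈xs) = x∈p∪q⁺ (inj₂ (∈⋃⁅⁆ xs x∈xs))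
  ∣⋃⁅⁆∣≤length : ∀ xs → ∣ ⋃⁅⁆ xs ∣ ≤ length xs
  ∣⋃⁅⁆∣≤length []       = ℕ.≤-reflexive (∣⊥∣≡0 m)
  ∣⋃⁅⁆∣≤length (x ∷ xs) =
    ℕ.≤-trans (∣p∪q∣≤∣p∣+∣q∣ ⁅ x ⁆ _) (ℕ.+-mono-≤ (ℕ.≤-reflexive (∣⁅x⁆∣≡1 x)) (∣⋃⁅⁆∣≤length xs))

-- Arithmetic and parity

m+m≤n+n⇒m≤n : ∀ {m n} → m + m ≤ n + n → m ≤ n
m+m≤n+n⇒m≤n h = ℕ.≮⇒≥ λ n<m → ℕ.<-irrefl refl (ℕ.<-≤-trans (ℕ.+-mono-< n<m n<m) h)

m*2≡m+m : ∀ m → m * 2 ≡ m + m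
m*2≡m+m m = trans (ℕ.*-comm m 2) (cong (m +_) (ℕ.+-identityʳ m))

n≤m+m⇒[n+1]/2≤m : ∀ {m n} → n ≤ m + m → (n + 1) / 2 ≤ m
n≤m+m⇒[n+1]/2≤m {m} {n} n≤m+m = ℕ.≤-pred (m<n*o⇒m/o<n n+1<[1+m]*2)
  where
  n+1<[1+m]*2 : n + 1 < suc m * 2
  n+1<[1+m]*2 rewrite m*2≡m+m m | ℕ.+-comm n 1 = s≤s (s≤s n≤m+m)

m+m≤n+1⇒m≤[n+1]/2 : ∀ {m n} → m + m ≤ n + 1 → m ≤ (n + 1) / 2
m+m≤n+1⇒m≤[n+1]/2 {m} {n} h =
  subst (_≤ (n + 1) / 2) (m*n/n≡m m 2) (/-monoˡ-≤ 2 (subst (_≤ n + 1) (sym (m*2≡m+m m)) h))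

parity-suc : ∀ m → parity (suc m) ≡ parity m ⁻¹
parity-suc m = trans (sym (ℙ.⁻¹-involutive (parity (suc m)))) (cong _⁻¹ (ℙ.suc-homo-⁻¹ m))

isEven : Parity → Bool
isEven 0ℙ = true
isEven 1ℙ = false

𝟙isEven+𝟙isEven⁻¹≡1 : ∀ p → 𝟙 (isEven p) + 𝟙 (isEven (p ⁻¹)) ≡ 1
𝟙isEven+𝟙isEven⁻¹≡1 0ℙ = refl
𝟙isEven+𝟙isEven⁻¹≡1 1ℙ = refl

p+q≡1ℙ⇒ : ∀ p q → p ℙ+ q ≡ 1ℙ → (p ≡ 1ℙ × q ≡ 0ℙ) ⊎ (p ≡ 0ℙ × q ≡ 1ℙ)
p+q≡1ℙ⇒ 0ℙ 1ℙ _ = inj₂ (refl , refl)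
p+q≡1ℙ⇒ 1ℙ 0ℙ _ = inj₁ (refl , refl)

p+q⁻¹≡[p+q]⁻¹ : ∀ p q → p ℙ+ q ⁻¹ ≡ (p ℙ+ q) ⁻¹
p+q⁻¹≡[p+q]⁻¹ 0ℙ q = refl
p+q⁻¹≡[p+q]⁻¹ 1ℙ q = refl

∑isEven-parity : ∀ m → let e = ∑[ i < m ] 𝟙 (isEven (parity (toℕ i))) in e + e ≤ m + 1
∑isEven-parity zero          = z≤n
∑isEven-parity (suc zero)    = ℕ.≤-refl
∑isEven-parity (suc (suc m)) =
  s≤s (ℕ.≤-trans (ℕ.≤-reflexive (ℕ.+-suc e e)) (s≤s (∑isEven-parity m)))
  where e = ∑[ i < m ] 𝟙 (isEven (parity (toℕ i)))

-- A record rather than a function of adj, so that the endpoints can be inferred.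
record Adjacent (G : Graph) (u v : Fin (n G)) : Set where
  constructor adjacent
  field isAdjacent : T (adj G u v)

open Adjacent

Adjacent-sym : (G : Graph) {u v : Fin (n G)} → Adjacent G u v → Adjacent G v u
Adjacent-sym G {u} {v} (adjacent u~v) = adjacent (subst T (Graph.sym G u v) u~v)

degree : (G : Graph) → Fin (n G) → ℕ
degree G v = ∣ N G v ∣

∈N⇔Adjacent : (G : Graph) {u v : Fin (n G)} → u ∈ N G v ⇔ Adjacent G v u
∈N⇔Adjacent G {u} {v} = mk⇔
  (λ u∈N → adjacent (Equivalence.from T-≡ (trans (sym (lookup-N u)) (Vec.[]=⇒lookup u∈N))))
  (λ v~u → Vec.lookup⇒[]= u _ (trans (lookup-N u) (Equivalence.to T-≡ (isAdjacent v~u))))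
  where
  lookup-N : ∀ u → lookup (N G v) u ≡ adj G v u
  lookup-N = Vec.lookup∘tabulate (adj G v)

∩'≡∩ : (p q : Subset m) → p ∩' q ≡ p ∩ q
∩'≡∩ p q = begin
  tabulate (λ i → ⌊ i ∈? p ⌋ ∧ ⌊ i ∈? q ⌋)
    ≡⟨ Vec.tabulate-cong (λ i → cong₂ _∧_ (⌊∈?⌋≡lookup i p) (⌊∈?⌋≡lookup i q)) ⟩
  tabulate (λ i → lookup p i ∧ lookup q i)
    ≡⟨ Vec.tabulate-cong (λ i → sym (Vec.lookup-zipWith _∧_ i p q)) ⟩
  tabulate (lookup (p ∩ q))
    ≡⟨ Vec.tabulate∘lookup (p ∩ q) ⟩
  p ∩ q ∎

module _ (G : Graph) where

  δ≡∣N∩S∣ : (S : Subset (n G)) (v : Fin (n G)) → δ G S v ≡ ∣ N G v ∩ S ∣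
  δ≡∣N∩S∣ S v = cong ∣_∣ (∩'≡∩ (N G v) S)

  δ+δ∁≡degree : (S : Subset (n G)) (v : Fin (n G)) → δ G S v + δ G (∁ S) v ≡ degree G v
  δ+δ∁≡degree S v rewrite δ≡∣N∩S∣ S v | δ≡∣N∩S∣ (∁ S) v = ∣p∩q∣+∣p∩∁q∣≡∣p∣ (N G v) S

  length≤δ : {S : Subset (n G)} {v : Fin (n G)} {us : List (Fin (n G))} →
             Unique us → All (λ u → Adjacent G v u × u ∈ S) us → length us ≤ δ G S v
  length≤δ {S} {v} uniq us∈N∩S rewrite δ≡∣N∩S∣ S v =
    length≤∣p∣ uniq (All.map (λ (v~u , u∈S) → x∈p∩q⁺ (Equivalence.from (∈N⇔Adjacent G) v~u , u∈S))
                             us∈N∩S)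

  degree≤length : {v : Fin (n G)} (us : List (Fin (n G))) →
                  (∀ {u} → Adjacent G v u → u ∈ₗ us) → degree G v ≤ length us
  degree≤length us N⊆us = ∣p∣≤length us (N⊆us ∘ Equivalence.to (∈N⇔Adjacent G))

module _ (G : Graph) (degree≤4 : ∀ v → degree G v ≤ 4) {S : Subset (n G)} where

  δ+δ∁≤4 : ∀ v → δ G S v + δ G (∁ S) v ≤ 4
  δ+δ∁≤4 v = ℕ.≤-trans (ℕ.≤-reflexive (δ+δ∁≡degree G S v)) (degree≤4 v)

  3≤δ⇒offensive : ∀ {v} → 3 ≤ δ G S v → δ G (∁ S) v + 1 ≤ δ G S v
  3≤δ⇒offensive {v} 3≤δ = ℕ.≤-trans (ℕ.+-monoˡ-≤ 1 δ∁≤1) (ℕ.≤-trans (ℕ.n≤1+n 2) 3≤δ)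
    where
    δ∁≤1 : δ G (∁ S) v ≤ 1
    δ∁≤1 = ℕ.+-cancelˡ-≤ 3 _ _ (ℕ.≤-trans (ℕ.+-monoˡ-≤ _ 3≤δ) (δ+δ∁≤4 v))

  module _ (goa : IsGOA G S) where

    IsGOA⇒∁-path-free : ∀ {u v w} → Adjacent G v u → Adjacent G v w → u ≢ w →
                        u ∈ ∁ S → v ∈ ∁ S → w ∈ ∁ S → ⊥
    IsGOA⇒∁-path-free {u} {v} {w} v~u v~w u≢w u∈∁S v∈∁S w∈∁S =
      contradiction (ℕ.≤-trans (ℕ.+-mono-≤ 3≤δ 2≤δ∁) (δ+δ∁≤4 v)) (ℕ.<-irrefl refl)
      where
      2≤δ∁ : 2 ≤ δ G (∁ S) v
      2≤δ∁ = length≤δ G ((u≢w ∷ []) ∷ [] ∷ []) ((v~u , u∈∁S) ∷ (v~w , w∈∁S) ∷ [])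
      3≤δ : 3 ≤ δ G S v
      3≤δ = ℕ.≤-trans (ℕ.+-monoˡ-≤ 1 2≤δ∁) (proj₂ goa v (x∈∁p⇒x∉p v∈∁S))

    -- Three vertices of the 4-cycle w x z y always form a path, which the complement cannot contain.
    IsGOA⇒∁-square≤2 : ∀ {w x y z} → Adjacent G w x → Adjacent G w y → Adjacent G z x → Adjacent G z y →
                       w ≢ z → x ≢ y → χ (∁ S) w + χ (∁ S) x + χ (∁ S) y + χ (∁ S) z ≤ 2
    IsGOA⇒∁-square≤2 {w} {x} {y} {z} w~x w~y z~x z~y w≢z x≢y
      with w ∈? ∁ S | x ∈? ∁ S | y ∈? ∁ S | z ∈? ∁ S
    ... | yes w∁ | yes x∁ | yes y∁ | _      = ⊥-elim (IsGOA⇒∁-path-free w~x w~y x≢y x∁ w∁ y∁)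
    ... | yes w∁ | yes x∁ | no _   | yes z∁ =
      ⊥-elim (IsGOA⇒∁-path-free (Adjacent-sym G w~x) (Adjacent-sym G z~x) w≢z w∁ x∁ z∁)
    ... | yes w∁ | no _   | yes y∁ | yes z∁ =
      ⊥-elim (IsGOA⇒∁-path-free (Adjacent-sym G w~y) (Adjacent-sym G z~y) w≢z w∁ y∁ z∁)
    ... | no _   | yes x∁ | yes y∁ | yes z∁ = ⊥-elim (IsGOA⇒∁-path-free z~x z~y x≢y x∁ z∁ y∁)
    ... | yes _ | yes _ | no _  | no _  = ℕ.≤-refl
    ... | yes _ | no _  | yes _ | no _  = ℕ.≤-refl
    ... | yes _ | no _  | no _  | yes _ = ℕ.≤-refl
    ... | no _  | yes _ | yes _ | no _  = ℕ.≤-refl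
    ... | no _  | yes _ | no _  | yes _ = ℕ.≤-refl
    ... | no _  | no _  | yes _ | yes _ = ℕ.≤-refl
    ... | yes _ | no _  | no _  | no _  = ℕ.n≤1+n 1
    ... | no _  | yes _ | no _  | no _  = ℕ.n≤1+n 1
    ... | no _  | no _  | yes _ | no _  = ℕ.n≤1+n 1
    ... | no _  | no _  | no _  | yes _ = ℕ.n≤1+n 1
    ... | no _  | no _  | no _  | no _  = z≤n

-- Cycles

module _ {k : ℕ} where

  next : Fin (suc k) → Fin (suc k)
  next i with k ℕ.≟ toℕ i
  ... | yes _   = zero
  ... | no k≢i = suc (Fin.lower₁ i k≢i)

  prev : Fin (suc k) → Fin (suc k)
  prev zero    = Fin.fromℕ k
  prev (suc i) = Fin.inject₁ i

  next-last : {i : Fin (suc k)} → k ≡ toℕ i → next i ≡ zero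
  next-last {i} k≡i with k ℕ.≟ toℕ i
  ... | yes _   = refl
  ... | no k≢i = contradiction k≡i k≢i

  toℕ-next : {i : Fin (suc k)} → k ≢ toℕ i → toℕ (next i) ≡ suc (toℕ i)
  toℕ-next {i} k≢i with k ℕ.≟ toℕ i
  ... | yes k≡i  = contradiction k≡i k≢i
  ... | no k≢i′ = cong suc (FP.toℕ-lower₁ i k≢i′)

  prev-next : (i : Fin (suc k)) → prev (next i) ≡ i
  prev-next i with k ℕ.≟ toℕ i
  ... | yes k≡i = FP.toℕ-injective (trans (FP.toℕ-fromℕ k) k≡i)
  ... | no k≢i  = FP.inject₁-lower₁ i k≢i

  next-prev : (i : Fin (suc k)) → next (prev i) ≡ i
  next-prev zero    = next-last (sym (FP.toℕ-fromℕ k))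
  next-prev (suc i) = FP.toℕ-injective (trans (toℕ-next (FP.toℕ-inject₁-≢ i)) (cong suc (FP.toℕ-inject₁ i)))

  nextₚ : Permutation (suc k) (suc k)
  nextₚ = permutation next prev next-prev prev-next

  next≢id : 1 ≤ k → (i : Fin (suc k)) → next i ≢ i
  next≢id 1≤k i next≡i = case k ℕ.≟ toℕ i of λ where
    (yes k≡i) → ℕ.<⇒≢ 1≤k (sym (trans k≡i (cong toℕ (trans (sym next≡i) (next-last k≡i)))))
    (no k≢i)  → ℕ.1+n≢n (trans (sym (toℕ-next k≢i)) (cong toℕ next≡i))

  next²≢id : 2 ≤ k → (i : Fin (suc k)) → next (next i) ≢ i
  next²≢id 2≤k i next²≡i = case k ℕ.≟ toℕ i of λ where
    (yes k≡i) → ℕ.<⇒≢ 2≤k (sym (begin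
      k                     ≡⟨ k≡i ⟩
      toℕ i                 ≡⟨ cong toℕ next²≡i ⟨
      toℕ (next (next i))   ≡⟨ cong (toℕ ∘ next) (next-last k≡i) ⟩
      toℕ (next zero)       ≡⟨ toℕ-next (ℕ.<⇒≢ (ℕ.<-trans (s≤s z≤n) 2≤k) ∘ sym) ⟩
      1                     ∎))
    (no k≢i) → case k ℕ.≟ toℕ (next i) of λ where
      (yes k≡i+1) → ℕ.<⇒≢ 2≤k (sym (begin
        k                  ≡⟨ k≡i+1 ⟩
        toℕ (next i)       ≡⟨ toℕ-next k≢i ⟩
        suc (toℕ i)        ≡⟨ cong (suc ∘ toℕ) next²≡i ⟨
        suc (toℕ (next (next i))) ≡⟨ cong (suc ∘ toℕ) (next-last k≡i+1) ⟩
        1                  ∎))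
      (no k≢i+1)  → ℕ.<⇒≢ (ℕ.m<n+m (toℕ i) {2} (s≤s z≤n)) (begin
        toℕ i                 ≡⟨ cong toℕ next²≡i ⟨
        toℕ (next (next i))   ≡⟨ toℕ-next k≢i+1 ⟩
        suc (toℕ (next i))    ≡⟨ cong suc (toℕ-next k≢i) ⟩
        2 + toℕ i             ∎)

  next≢prev : 2 ≤ k → (i : Fin (suc k)) → next i ≢ prev i
  next≢prev 2≤k i next≡prev = next²≢id 2≤k i (trans (cong next next≡prev) (next-prev i))

  prev≢id : 1 ≤ k → (i : Fin (suc k)) → prev i ≢ i
  prev≢id 1≤k i prev≡i = next≢id 1≤k i (trans (cong next (sym prev≡i)) (next-prev i))

  IsNext : Fin (suc k) → Fin (suc k) → Set
  IsNext i j = suc (toℕ i) ≡ toℕ j ⊎ (suc (toℕ i) ≡ suc k × toℕ j ≡ 0)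

  IsNext⇒≡next : {i j : Fin (suc k)} → IsNext i j → j ≡ next i
  IsNext⇒≡next {i} {j} (inj₁ 1+i≡j) = FP.toℕ-injective (trans (sym 1+i≡j) (sym (toℕ-next k≢i)))
    where
    k≢i : k ≢ toℕ i
    k≢i k≡i = ℕ.<-irrefl (sym (trans (cong suc k≡i) 1+i≡j)) (FP.toℕ<n j)
  IsNext⇒≡next (inj₂ (1+i≡1+k , j≡0)) =
    trans (FP.toℕ-injective j≡0) (sym (next-last (sym (ℕ.suc-injective 1+i≡1+k))))

  IsNext-next : (i : Fin (suc k)) → IsNext i (next i)
  IsNext-next i = case k ℕ.≟ toℕ i of λ where
    (yes k≡i) → inj₂ (cong suc (sym k≡i) , cong toℕ (next-last k≡i))
    (no k≢i)  → inj₁ (sym (toℕ-next k≢i))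

  T-cycAdj⇔ : {i j : Fin (suc k)} → T (cycAdj (suc k) i j) ⇔ (IsNext i j ⊎ IsNext j i)
  T-cycAdj⇔ {i} {j} = mk⇔ to′ from′
    where
    open Equivalence
    i→j = suc (toℕ i) ℕ.≟ toℕ j
    j→i = suc (toℕ j) ℕ.≟ toℕ i
    i-last = suc (toℕ i) ℕ.≟ suc k
    j-last = suc (toℕ j) ℕ.≟ suc k
    wrap-i = ⌊ i-last ⌋ ∧ ⌊ toℕ j ℕ.≟ 0 ⌋
    to′ : T (cycAdj (suc k) i j) → IsNext i j ⊎ IsNext j i
    to′ t with to (T-∨ {⌊ i→j ⌋}) t
    ... | inj₁ s = inj₁ (inj₁ (toWitness s))
    ... | inj₂ t with to (T-∨ {⌊ j→i ⌋}) t
    ... | inj₁ s = inj₂ (inj₁ (toWitness s))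
    ... | inj₂ t with to (T-∨ {wrap-i}) t
    ... | inj₁ w = inj₁ (inj₂ (Product.map toWitness toWitness (to (T-∧ {⌊ i-last ⌋}) w)))
    ... | inj₂ w = inj₂ (inj₂ (Product.map toWitness toWitness (to (T-∧ {⌊ j-last ⌋}) w)))
    from′ : IsNext i j ⊎ IsNext j i → T (cycAdj (suc k) i j)
    from′ (inj₁ (inj₁ s)) = from (T-∨ {⌊ i→j ⌋}) (inj₁ (fromWitness s))
    from′ (inj₂ (inj₁ s)) = from (T-∨ {⌊ i→j ⌋}) (inj₂ (from (T-∨ {⌊ j→i ⌋}) (inj₁ (fromWitness s))))
    from′ (inj₁ (inj₂ (s , z))) = from (T-∨ {⌊ i→j ⌋}) (inj₂ (from (T-∨ {⌊ j→i ⌋}) (inj₂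
      (from (T-∨ {wrap-i}) (inj₁ (from (T-∧ {⌊ i-last ⌋}) (fromWitness s , fromWitness z)))))))
    from′ (inj₂ (inj₂ (s , z))) = from (T-∨ {⌊ i→j ⌋}) (inj₂ (from (T-∨ {⌊ j→i ⌋}) (inj₂
      (from (T-∨ {wrap-i}) (inj₂ (from (T-∧ {⌊ j-last ⌋}) (fromWitness s , fromWitness z)))))))

  parity-next : {i : Fin (suc k)} → k ≢ toℕ i → parity (toℕ (next i)) ≡ parity (toℕ i) ⁻¹
  parity-next {i} k≢i = trans (cong parity (toℕ-next k≢i)) (parity-suc (toℕ i))

  parity-prev : (i : Fin (suc k)) → i ≢ zero → parity (toℕ (prev i)) ≡ parity (toℕ i) ⁻¹
  parity-prev zero    i≢0 = contradiction refl i≢0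
  parity-prev (suc j) _   = trans (cong parity (FP.toℕ-inject₁ j)) (sym (ℙ.suc-homo-⁻¹ (toℕ j)))

  parity-next-even : parity (suc k) ≡ 0ℙ → (i : Fin (suc k)) → parity (toℕ (next i)) ≡ parity (toℕ i) ⁻¹
  parity-next-even even i = case k ℕ.≟ toℕ i of λ where
    (yes k≡i) → begin
      parity (toℕ (next i)) ≡⟨ cong (parity ∘ toℕ) (next-last k≡i) ⟩
      0ℙ                    ≡⟨ even ⟨
      parity (suc k)        ≡⟨ parity-suc k ⟩
      parity k ⁻¹           ≡⟨ cong (λ m → parity m ⁻¹) k≡i ⟩
      parity (toℕ i) ⁻¹     ∎
    (no k≢i)  → parity-next k≢i

  odd⇒next-even : (i : Fin (suc k)) → parity (toℕ i) ≡ 1ℙ → parity (toℕ (next i)) ≡ 0ℙ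
  odd⇒next-even i odd = case k ℕ.≟ toℕ i of λ where
    (yes k≡i) → cong (parity ∘ toℕ) (next-last k≡i)
    (no k≢i)  → trans (parity-next k≢i) (cong _⁻¹ odd)

  odd⇒prev-even : (i : Fin (suc k)) → parity (toℕ i) ≡ 1ℙ → parity (toℕ (prev i)) ≡ 0ℙ
  odd⇒prev-even i odd = trans (parity-prev i i≢0) (cong _⁻¹ odd)
    where
    i≢0 : i ≢ zero
    i≢0 refl = case odd of λ ()

module _ {k : ℕ} (3≤1+k : 3 ≤ suc k) where

  private
    Cₖ = C (suc k) 3≤1+k

  2≤k : 2 ≤ k
  2≤k = ℕ.≤-pred 3≤1+k

  1≤k : 1 ≤ k
  1≤k = ℕ.≤-trans (s≤s z≤n) 2≤k

  Adjacent-next : (i : Fin (suc k)) → Adjacent Cₖ i (next i)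
  Adjacent-next i = adjacent (Equivalence.from T-cycAdj⇔ (inj₁ (IsNext-next i)))

  Adjacent-prev : (i : Fin (suc k)) → Adjacent Cₖ i (prev i)
  Adjacent-prev i = Adjacent-sym Cₖ (subst (Adjacent Cₖ (prev i)) (next-prev i) (Adjacent-next (prev i)))

  Adjacent⇒next⊎prev : {i j : Fin (suc k)} → Adjacent Cₖ i j → j ≡ next i ⊎ j ≡ prev i
  Adjacent⇒next⊎prev {i} {j} (adjacent i~j) =
    Sum.map IsNext⇒≡next (λ j→i → trans (sym (prev-next j)) (cong prev (sym (IsNext⇒≡next j→i))))
            (Equivalence.to T-cycAdj⇔ i~j)

  parity-flipping-neighbour : (i : Fin (suc k)) → ∃ λ j → Adjacent Cₖ i j × parity (toℕ j) ≡ parity (toℕ i) ⁻¹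
  parity-flipping-neighbour i = case k ℕ.≟ toℕ i of λ where
    (yes k≡i) → prev i , Adjacent-prev i , parity-prev i (λ { refl → contradiction (sym k≡i) (ℕ.<⇒≢ 1≤k) })
    (no k≢i)  → next i , Adjacent-next i , parity-next k≢i

-- Cartesian products

module _ {m₁ m₂ : ℕ} where

  ∀-combine : {P : Fin (m₁ * m₂) → Set} → (∀ (a : Fin m₁) (b : Fin m₂) → P (combine a b)) → ∀ x → P x
  ∀-combine {P} P-combine x = subst P (FP.combine-remQuot {m₁} m₂ x) (P-combine _ _)

  map-combine : (Fin m₁ → Fin m₁) → (Fin m₂ → Fin m₂) → Fin (m₁ * m₂) → Fin (m₁ * m₂)
  map-combine f g x = uncurry combine (Product.map f g (remQuot m₂ x))

  map-combine-combine : ∀ f g (a : Fin m₁) (b : Fin m₂) → map-combine f g (combine a b) ≡ combine (f a) (g b)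
  map-combine-combine f g a b = cong (uncurry combine ∘ Product.map f g) (FP.remQuot-combine a b)

  map-combine-inverse : ∀ {f f′ g g′} → (∀ a → f (f′ a) ≡ a) → (∀ b → g (g′ b) ≡ b) →
                        ∀ x → map-combine f g (map-combine f′ g′ x) ≡ x
  map-combine-inverse {f} {f′} {g} {g′} f∘f′ g∘g′ = ∀-combine λ a b → begin
    map-combine f g (map-combine f′ g′ (combine a b)) ≡⟨ cong (map-combine f g) (map-combine-combine f′ g′ a b) ⟩
    map-combine f g (combine (f′ a) (g′ b))           ≡⟨ map-combine-combine f g (f′ a) (g′ b) ⟩
    combine (f (f′ a)) (g (g′ b))                     ≡⟨ cong₂ combine (f∘f′ a) (g∘g′ b) ⟩
    combine a b                                       ∎

  _⊗ₚ_ : Permutation m₁ m₁ → Permutation m₂ m₂ → Permutation (m₁ * m₂) (m₁ * m₂)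
  π ⊗ₚ ρ = permutation (map-combine (π ⟨$⟩ʳ_) (ρ ⟨$⟩ʳ_)) (map-combine (π ⟨$⟩ˡ_) (ρ ⟨$⟩ˡ_))
    (map-combine-inverse {π ⟨$⟩ʳ_} {π ⟨$⟩ˡ_} {ρ ⟨$⟩ʳ_} {ρ ⟨$⟩ˡ_} (λ _ → Perm.inverseʳ π) (λ _ → Perm.inverseʳ ρ))
    (map-combine-inverse {π ⟨$⟩ˡ_} {π ⟨$⟩ʳ_} {ρ ⟨$⟩ˡ_} {ρ ⟨$⟩ʳ_} (λ _ → Perm.inverseˡ π) (λ _ → Perm.inverseˡ ρ))

module _ (G H : Graph) where

  Adjacent-□⇔ : ∀ {a c : Fin (n G)} {b d : Fin (n H)} → Adjacent (G □ H) (combine a b) (combine c d) ⇔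
                ((a ≡ c × Adjacent H b d) ⊎ (Adjacent G a c × b ≡ d))
  Adjacent-□⇔ {a} {c} {b} {d} = mk⇔ to′ from′
    where
    open Equivalence
    adj-combine : adj (G □ H) (combine a b) (combine c d) ≡ pairAdj G H (a , b) (c , d)
    adj-combine = cong₂ (pairAdj G H) (FP.remQuot-combine a b) (FP.remQuot-combine c d)
    to′ : Adjacent (G □ H) (combine a b) (combine c d) → (a ≡ c × Adjacent H b d) ⊎ (Adjacent G a c × b ≡ d)
    to′ (adjacent ab~cd) with to (T-∨ {⌊ a FP.≟ c ⌋ ∧ adj H b d}) (subst T adj-combine ab~cd)
    ... | inj₁ t = inj₁ (Product.map toWitness adjacent (to (T-∧ {⌊ a FP.≟ c ⌋}) t))
    ... | inj₂ t = inj₂ (Product.map adjacent toWitness (to (T-∧ {adj G a c}) t))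
    from′ : (a ≡ c × Adjacent H b d) ⊎ (Adjacent G a c × b ≡ d) → Adjacent (G □ H) (combine a b) (combine c d)
    from′ (inj₁ (a≡c , b~d)) = adjacent (subst T (sym adj-combine)
      (from (T-∨ {⌊ a FP.≟ c ⌋ ∧ adj H b d}) (inj₁ (from (T-∧ {⌊ a FP.≟ c ⌋}) (fromWitness a≡c , isAdjacent b~d)))))
    from′ (inj₂ (a~c , b≡d)) = adjacent (subst T (sym adj-combine)
      (from (T-∨ {⌊ a FP.≟ c ⌋ ∧ adj H b d}) (inj₂ (from (T-∧ {adj G a c}) (isAdjacent a~c , fromWitness b≡d)))))

  Adjacent-□ˡ : ∀ {a c : Fin (n G)} (b : Fin (n H)) → Adjacent G a c → Adjacent (G □ H) (combine a b) (combine c b)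
  Adjacent-□ˡ b a~c = Equivalence.from Adjacent-□⇔ (inj₂ (a~c , refl))

  Adjacent-□ʳ : ∀ (a : Fin (n G)) {b d : Fin (n H)} → Adjacent H b d → Adjacent (G □ H) (combine a b) (combine a d)
  Adjacent-□ʳ a b~d = Equivalence.from Adjacent-□⇔ (inj₁ (refl , b~d))

-- The torus

module Torus {k l : ℕ} (3≤r : 3 ≤ suc k) (3≤t : 3 ≤ suc l) where

  Cᵣ Cₜ 𝕋 : Graph
  Cᵣ = C (suc k) 3≤r
  Cₜ = C (suc l) 3≤t
  𝕋 = Cᵣ □ Cₜ

  V : Set
  V = Fin (n 𝕋)

  ⟨_,_⟩ : Fin (suc k) → Fin (suc l) → V
  ⟨ a , b ⟩ = combine a b

  ⟨,⟩-≢ˡ : ∀ {a c} b d → a ≢ c → ⟨ a , b ⟩ ≢ ⟨ c , d ⟩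
  ⟨,⟩-≢ˡ {a} {c} b d a≢c = a≢c ∘ FP.combine-injectiveˡ a b c d

  ⟨,⟩-≢ʳ : ∀ a c {b d} → b ≢ d → ⟨ a , b ⟩ ≢ ⟨ c , d ⟩
  ⟨,⟩-≢ʳ a c {b} {d} b≢d = b≢d ∘ FP.combine-injectiveʳ a b c d

  neighbours : Fin (suc k) → Fin (suc l) → List V
  neighbours a b = ⟨ next a , b ⟩ ∷ ⟨ prev a , b ⟩ ∷ ⟨ a , next b ⟩ ∷ ⟨ a , prev b ⟩ ∷ []

  Adjacent⇒∈neighbours : ∀ a b {v} → Adjacent 𝕋 ⟨ a , b ⟩ v → v ∈ₗ neighbours a b
  Adjacent⇒∈neighbours a b {v} = ∀-combine neighbour v
    where
    neighbour : ∀ c d → Adjacent 𝕋 ⟨ a , b ⟩ ⟨ c , d ⟩ → ⟨ c , d ⟩ ∈ₗ neighbours a b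
    neighbour c d ab~cd with Equivalence.to (Adjacent-□⇔ Cᵣ Cₜ {a} {c} {b} {d}) ab~cd
    ... | inj₁ (refl , b~d) with Adjacent⇒next⊎prev 3≤t b~d
    ...   | inj₁ refl = there (there (here refl))
    ...   | inj₂ refl = there (there (there (here refl)))
    neighbour c d ab~cd | inj₂ (a~c , refl) with Adjacent⇒next⊎prev 3≤r a~c
    ...   | inj₁ refl = here refl
    ...   | inj₂ refl = there (here refl)

  degree≤4 : ∀ v → degree 𝕋 v ≤ 4
  degree≤4 = ∀-combine λ a b → degree≤length 𝕋 (neighbours a b) (Adjacent⇒∈neighbours a b)

  σ τ : Permutation (n 𝕋) (n 𝕋)
  σ = nextₚ {k} ⊗ₚ Perm.id {suc l}
  τ = Perm.id {suc k} ⊗ₚ nextₚ {l}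

  σ⟨,⟩ : ∀ a b → σ ⟨$⟩ʳ ⟨ a , b ⟩ ≡ ⟨ next a , b ⟩
  σ⟨,⟩ = map-combine-combine {suc k} {suc l} next id

  τ⟨,⟩ : ∀ a b → τ ⟨$⟩ʳ ⟨ a , b ⟩ ≡ ⟨ a , next b ⟩
  τ⟨,⟩ = map-combine-combine {suc k} {suc l} id next

  module _ {S : Subset (n 𝕋)} (goa : IsGOA 𝕋 S) where

    private
      χ∁ : V → ℕ
      χ∁ = χ (∁ S)

    ∁-square≤2 : ∀ x → χ∁ x + χ∁ (σ ⟨$⟩ʳ x) + χ∁ (τ ⟨$⟩ʳ x) + χ∁ (σ ⟨$⟩ʳ (τ ⟨$⟩ʳ x)) ≤ 2
    ∁-square≤2 = ∀-combine square
      where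
      square : ∀ a b → let x = ⟨ a , b ⟩ in
               χ∁ x + χ∁ (σ ⟨$⟩ʳ x) + χ∁ (τ ⟨$⟩ʳ x) + χ∁ (σ ⟨$⟩ʳ (τ ⟨$⟩ʳ x)) ≤ 2
      square a b rewrite σ⟨,⟩ a b | τ⟨,⟩ a b | σ⟨,⟩ a (next b) =
        IsGOA⇒∁-square≤2 𝕋 degree≤4 goa
          (Adjacent-□ˡ Cᵣ Cₜ b (Adjacent-next 3≤r a))
          (Adjacent-□ʳ Cᵣ Cₜ a (Adjacent-next 3≤t b))
          (Adjacent-□ʳ Cᵣ Cₜ (next a) (Adjacent-sym Cₜ (Adjacent-next 3≤t b)))
          (Adjacent-□ˡ Cᵣ Cₜ (next b) (Adjacent-sym Cᵣ (Adjacent-next 3≤r a)))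
          (⟨,⟩-≢ˡ b (next b) (next≢id (1≤k 3≤r) a ∘ sym))
          (⟨,⟩-≢ˡ b (next b) (next≢id (1≤k 3≤r) a))

    ∣∁S∣+∣∁S∣≤∣V∣ : ∣ ∁ S ∣ + ∣ ∁ S ∣ ≤ n 𝕋
    ∣∁S∣+∣∁S∣≤∣V∣ = m+m≤n+n⇒m≤n (subst₂ _≤_ squares≡4t 2s≡2N (∑-mono-≤ (n 𝕋) ∁-square≤2))
      where
      t = ∣ ∁ S ∣
      squares≡4t : ∑[ x < n 𝕋 ] (χ∁ x + χ∁ (σ ⟨$⟩ʳ x) + χ∁ (τ ⟨$⟩ʳ x) + χ∁ (σ ⟨$⟩ʳ (τ ⟨$⟩ʳ x))) ≡ t + t + (t + t)
      squares≡4t = trans (∑-square σ τ χ∁)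
        (trans (cong (λ s → s + s + s + s) (sym (∣p∣≡∑χ (∁ S)))) (ℕ.+-assoc (t + t) t t))
      2s≡2N : ∑[ x < n 𝕋 ] 2 ≡ n 𝕋 + n 𝕋
      2s≡2N = trans (∑-const (n 𝕋) 2) (m*2≡m+m (n 𝕋))

    [∣V∣+1]/2≤∣S∣ : (n 𝕋 + 1) / 2 ≤ ∣ S ∣
    [∣V∣+1]/2≤∣S∣ = n≤m+m⇒[n+1]/2≤m (subst (_≤ s + s) (∣p∣+∣∁p∣≡n S) (ℕ.+-monoʳ-≤ s t≤s))
      where
      s = ∣ S ∣
      t = ∣ ∁ S ∣
      t≤s : t ≤ s
      t≤s = ℕ.+-cancelʳ-≤ t t s (subst (t + t ≤_) (sym (∣p∣+∣∁p∣≡n S)) ∣∁S∣+∣∁S∣≤∣V∣)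

  private
    colourᶜ : Fin (suc k) × Fin (suc l) → Parity
    colourᶜ (a , b) = parity (toℕ a) ℙ+ parity (toℕ b)

  colour : V → Parity
  colour x = colourᶜ (remQuot {suc k} (suc l) x)

  colour⟨,⟩ : ∀ a b → colour ⟨ a , b ⟩ ≡ parity (toℕ a) ℙ+ parity (toℕ b)
  colour⟨,⟩ a b = cong colourᶜ (FP.remQuot-combine a b)

  checkerboard : Subset (n 𝕋)
  checkerboard = tabulate (isEven ∘ colour)

  even⇒∈checkerboard : ∀ {x} → colour x ≡ 0ℙ → x ∈ checkerboard
  even⇒∈checkerboard {x} even =
    Vec.lookup⇒[]= x _ (trans (Vec.lookup∘tabulate (isEven ∘ colour) x) (cong isEven even))

  ∉checkerboard⇒odd : ∀ {x} → x ∉ checkerboard → colour x ≡ 1ℙ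
  ∉checkerboard⇒odd {x} x∉ with colour x in eq
  ... | 0ℙ = contradiction (even⇒∈checkerboard eq) x∉
  ... | 1ℙ = refl

  3≤δ-checkerboard : ∀ a b → colour ⟨ a , b ⟩ ≡ 1ℙ → 3 ≤ δ 𝕋 checkerboard ⟨ a , b ⟩
  3≤δ-checkerboard a b odd with p+q≡1ℙ⇒ _ _ (trans (sym (colour⟨,⟩ a b)) odd)
  ... | inj₁ (a-odd , b-even) with parity-flipping-neighbour 3≤t b
  ...   | j , b~j , j-odd =
    length≤δ 𝕋
      ((⟨,⟩-≢ˡ b b (next≢prev (2≤k 3≤r) a) ∷ ⟨,⟩-≢ˡ b j (next≢id (1≤k 3≤r) a) ∷ [])
       ∷ (⟨,⟩-≢ˡ b j (prev≢id (1≤k 3≤r) a) ∷ []) ∷ [] ∷ [])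
      ( (Adjacent-□ˡ Cᵣ Cₜ b (Adjacent-next 3≤r a) ,
         even⇒∈checkerboard (trans (colour⟨,⟩ (next a) b) (cong₂ _ℙ+_ (odd⇒next-even a a-odd) b-even)))
      ∷ (Adjacent-□ˡ Cᵣ Cₜ b (Adjacent-prev 3≤r a) ,
         even⇒∈checkerboard (trans (colour⟨,⟩ (prev a) b) (cong₂ _ℙ+_ (odd⇒prev-even a a-odd) b-even)))
      ∷ (Adjacent-□ʳ Cᵣ Cₜ a b~j ,
         even⇒∈checkerboard (trans (colour⟨,⟩ a j) (cong₂ _ℙ+_ a-odd (trans j-odd (cong _⁻¹ b-even)))))
      ∷ [])
  3≤δ-checkerboard a b odd | inj₂ (a-even , b-odd) with parity-flipping-neighbour 3≤r a
  ...   | i , a~i , i-odd =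
    length≤δ 𝕋
      ((⟨,⟩-≢ʳ a a (next≢prev (2≤k 3≤t) b) ∷ ⟨,⟩-≢ʳ a i (next≢id (1≤k 3≤t) b) ∷ [])
       ∷ (⟨,⟩-≢ʳ a i (prev≢id (1≤k 3≤t) b) ∷ []) ∷ [] ∷ [])
      ( (Adjacent-□ʳ Cᵣ Cₜ a (Adjacent-next 3≤t b) ,
         even⇒∈checkerboard (trans (colour⟨,⟩ a (next b)) (cong₂ _ℙ+_ a-even (odd⇒next-even b b-odd))))
      ∷ (Adjacent-□ʳ Cᵣ Cₜ a (Adjacent-prev 3≤t b) ,
         even⇒∈checkerboard (trans (colour⟨,⟩ a (prev b)) (cong₂ _ℙ+_ a-even (odd⇒prev-even b b-odd))))
      ∷ (Adjacent-□ˡ Cᵣ Cₜ b a~i ,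
         even⇒∈checkerboard (trans (colour⟨,⟩ i b) (cong₂ _ℙ+_ (trans i-odd (cong _⁻¹ a-even)) b-odd)))
      ∷ [])

  checkerboard-IsGOA : IsGOA 𝕋 checkerboard
  checkerboard-IsGOA =
    (⟨ zero , zero ⟩ , even⇒∈checkerboard (colour⟨,⟩ zero zero)) ,
    ∀-combine λ a b ab∉ →
      3≤δ⇒offensive 𝕋 degree≤4 {v = ⟨ a , b ⟩} (3≤δ-checkerboard a b (∉checkerboard⇒odd ab∉))

  ∣checkerboard∣≡∑ : ∣ checkerboard ∣ ≡ ∑[ x < n 𝕋 ] 𝟙 (isEven (colour x))
  ∣checkerboard∣≡∑ = trans (∣p∣≡∑χ checkerboard) (sum-cong-≗ (χ-tabulate (isEven ∘ colour)))

  colour-τ : parity (suc l) ≡ 0ℙ → ∀ x → colour (τ ⟨$⟩ʳ x) ≡ colour x ⁻¹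
  colour-τ even = ∀-combine λ a b → begin
    colour (τ ⟨$⟩ʳ ⟨ a , b ⟩)              ≡⟨ cong colour (τ⟨,⟩ a b) ⟩
    colour ⟨ a , next b ⟩                  ≡⟨ colour⟨,⟩ a (next b) ⟩
    parity (toℕ a) ℙ+ parity (toℕ (next b)) ≡⟨ cong (parity (toℕ a) ℙ+_) (parity-next-even even b) ⟩
    parity (toℕ a) ℙ+ parity (toℕ b) ⁻¹    ≡⟨ p+q⁻¹≡[p+q]⁻¹ (parity (toℕ a)) (parity (toℕ b)) ⟩
    (parity (toℕ a) ℙ+ parity (toℕ b)) ⁻¹  ≡⟨ cong _⁻¹ (colour⟨,⟩ a b) ⟨
    colour ⟨ a , b ⟩ ⁻¹                    ∎

  colour≡parity : parity (suc l) ≡ 1ℙ → ∀ x → colour x ≡ parity (toℕ x)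
  colour≡parity odd = ∀-combine λ a b → begin
    colour ⟨ a , b ⟩
      ≡⟨ colour⟨,⟩ a b ⟩
    parity (toℕ a) ℙ+ parity (toℕ b)
      ≡⟨ cong (λ p → p ℙ* parity (toℕ a) ℙ+ parity (toℕ b)) odd ⟨
    parity (suc l) ℙ* parity (toℕ a) ℙ+ parity (toℕ b)
      ≡⟨ cong (_ℙ+ parity (toℕ b)) (ℙ.*-homo-* (suc l) (toℕ a)) ⟨
    parity (suc l * toℕ a) ℙ+ parity (toℕ b)
      ≡⟨ ℙ.+-homo-+ (suc l * toℕ a) (toℕ b) ⟨
    parity (suc l * toℕ a + toℕ b)
      ≡⟨ cong parity (FP.toℕ-combine a b) ⟨
    parity (toℕ ⟨ a , b ⟩) ∎

  ∣checkerboard∣+∣checkerboard∣≡∣V∣ : parity (suc l) ≡ 0ℙ → ∣ checkerboard ∣ + ∣ checkerboard ∣ ≡ n 𝕋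
  ∣checkerboard∣+∣checkerboard∣≡∣V∣ even = begin
    ∣ checkerboard ∣ + ∣ checkerboard ∣
      ≡⟨ cong₂ _+_ ∣checkerboard∣≡∑ (trans ∣checkerboard∣≡∑ (sym (∑-invariant τ (e ∘ colour)))) ⟩
    ∑[ x < n 𝕋 ] e (colour x) + ∑[ x < n 𝕋 ] e (colour (τ ⟨$⟩ʳ x))
      ≡⟨ ∑-distrib-+ (e ∘ colour) (e ∘ colour ∘ (τ ⟨$⟩ʳ_)) ⟨
    ∑[ x < n 𝕋 ] (e (colour x) + e (colour (τ ⟨$⟩ʳ x)))
      ≡⟨ sum-cong-≗ (λ x → trans (cong (λ p → e (colour x) + e p) (colour-τ even x))
                                 (𝟙isEven+𝟙isEven⁻¹≡1 (colour x))) ⟩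
    ∑[ x < n 𝕋 ] 1
      ≡⟨ trans (∑-const (n 𝕋) 1) (ℕ.*-identityʳ (n 𝕋)) ⟩
    n 𝕋 ∎
    where
    e : Parity → ℕ
    e = 𝟙 ∘ isEven

  ∣checkerboard∣+∣checkerboard∣≤∣V∣+1 : ∣ checkerboard ∣ + ∣ checkerboard ∣ ≤ n 𝕋 + 1
  ∣checkerboard∣+∣checkerboard∣≤∣V∣+1 with parity (suc l) in eq
  ... | 0ℙ = ℕ.≤-trans (ℕ.≤-reflexive (∣checkerboard∣+∣checkerboard∣≡∣V∣ eq)) (ℕ.m≤m+n (n 𝕋) 1)
  ... | 1ℙ = subst (λ c → c + c ≤ n 𝕋 + 1)
    (sym (trans ∣checkerboard∣≡∑ (sum-cong-≗ (cong (𝟙 ∘ isEven) ∘ colour≡parity eq))))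
    (∑isEven-parity (n 𝕋))

proposition17 : (r t : ℕ) (hr : 3 ≤ r) (ht : 3 ≤ t) →
    GOANumberIs (C r hr □ C t ht) ((r * t + 1) / 2)
proposition17 (suc k) (suc l) 3≤r 3≤t =
  (checkerboard , checkerboard-IsGOA , ℕ.≤-antisym upper ([∣V∣+1]/2≤∣S∣ checkerboard-IsGOA)) ,
  λ _ → [∣V∣+1]/2≤∣S∣
  where
  open Torus 3≤r 3≤t
  upper : ∣ checkerboard ∣ ≤ (suc k * suc l + 1) / 2
  upper = m+m≤n+1⇒m≤[n+1]/2 {n = n 𝕋} ∣checkerboard∣+∣checkerboard∣≤∣V∣+1
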